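{- Let $M$ be a simplicial model and $\mathcal{A}$ a simplicial action model. Then the Kripke models $F(M[\mathcal{A}])$ and $F(M)[F(\mathcal{A})]$ are isomorphic. Likewise, for a local proper Kripke model $N$ and a proper action model $\mathcal{B}$, the simplicial models $G(N[\mathcal{B}])$ and $G(N)[G(\mathcal{B})]$ are isomorphic.
   Context: Agents $A=\{a_0,\ldots,a_n\}$; $\mathit{AP}=\{p_{a,x}\mid a\in A,x\in\mathcal{V}\}$, $\mathit{AP}_a=\{p_{a,x}\mid x\in\mathcal{V}\}$; $\mathcal{L}_K$ is the language $\varphi::=p\mid\neg\varphi\mid\varphi\wedge\varphi\mid K_a\varphi$. A simplicial model $\langle C,\chi,\ell\rangle$: a simplicial complex whose facets (maximal simplexes) all have $n+1$ vertices, a coloring $\chi:\mathcal{V}(C)\to A$ injective on each simplex, and $\ell:\mathcal{V}(C)\to\mathscr{P}(\mathit{AP})$ with $\ell(v)\subseteq\mathit{AP}_{\chi(v)}$; $\ell(X)=\bigcup_{v\in X}\ell(v)$; semantics at facets: $X\models p$ iff $p\in\ell(X)$, $X\models K_a\varphi$ iff all facets $Y$ with $a\in\chi(X\cap Y)$ satisfy $\varphi$. A simplicial action model $\langle T,\chi,\mathsf{pre}\rangle$: a chromatic simplicial complex of the same kind with a map $\mathsf{pre}$ from its facets to $\mathcal{L}_K$. The cartesian product $C\times T$ of such complexes has vertices $(u,v)$ with $\chi(u)=\chi(v)$, colored by this common color, and simplexes $\{(u_0,v_0),\ldots,(u_k,v_k)\}$ with $\{u_i\}\in C$, $\{v_i\}\in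 T$, $\chi(u_i)=\chi(v_i)$. The product update $M[\mathcal{A}]$ is the subcomplex of $C\times T$ generated by the facets $X\times Y$ with $M,X\models\mathsf{pre}(Y)$, with labeling $\ell((u,v))=\ell(u)$. Kripke models $\langle S,\sim,L\rangle$ (equivalence relations $\sim_a$, $L:S\to\mathscr{P}(\mathit{AP})$), proper (distinct states distinguished by some $\sim_a$), local ($s\sim_a s'\Rightarrow L(s)\cap\mathit{AP}_a=L(s')\cap\mathit{AP}_a$); action models $\langle T,\sim,\mathsf{pre}\rangle$ (equivalences $\sim_a$ on $T$, $\mathsf{pre}:T\to\mathcal{L}_K$), proper as for Kripke frames; Kripke product update $N[\mathcal{B}]$: states $(s,t)$ with $N,s\models\mathsf{pre}(t)$, $(s,t)\sim_a(s',t')$ iff $s\sim_a s'$ and $t\sim_a t'$, valuation $L(s)$. $F$: sends a simplicial model (resp. simplicial action model) to the Kripke model (resp. action model) whose states (resp. action points) are its facets, with $X\sim_a Y$ iff $a\in\chi(X\cap Y)$, valuation $\ell(X)$ (resp. precondition $\mathsf{pre}(X)$). $G$: sends a Kripke model (resp. action model) with state set $S$ to the simplicial model (resp. simplicial action model) whose vertices are classes $[v^s_i]$ of $\{v^s_i\mid s\in S,0\le i\le n\}$ under $v^s_i\,R\,v^{s'}_i$ iff $s\sim_{a_i}s'$, with facets $\{[v^s_0],\ldots,[v^s_n]\}$, $\chi([v^s_i])=a_i$, and $\ell([v^s_i])=L(s)\cap\mathit{AP}_{a_i}$ (resp. precondition of the facet of $s$ equal to $\mathsf{pre}(s)$). An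 isomorphism of Kripke models is a bijection preserving and reflecting each $\sim_a$ and preserving valuations; an isomorphism of simplicial models is a bijective morphism whose inverse is a morphism. -}

module Defs where

open import Data.Nat using (ℕ; suc)
open import Data.Fin using (Fin)
open import Data.Product using (Σ; _×_; _,_; proj₁; proj₂)
open import Relation.Nullary using (¬_)
open import Relation.Binary.PropositionalEquality using (_≡_)
open import Relation.Binary.Structures using (IsEquivalence)
open import Function.Bundles using (_⇔_)

Ag : ℕ → Set
Ag n = Fin (suc n)

-- AP = { p_{a,x} | a ∈ A, x ∈ 𝒱 }, p_{a,x} represented by (a , x);
-- AP_a = the pairs whose first component is a
AP : ℕ → Set → Set
AP n 𝒱 = Ag n × 𝒱

data Form (n : ℕ) (𝒱 : Set) : Set where
  atom : AP n 𝒱 → Form n 𝒱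
  ¬ᶠ_  : Form n 𝒱 → Form n 𝒱
  _∧ᶠ_ : Form n 𝒱 → Form n 𝒱 → Form n 𝒱
  K    : Ag n → Form n 𝒱 → Form n 𝒱

-- Vertices form a setoid (needed because G builds vertices as
-- equivalence classes, and there are no quotient types).
-- Since χ is injective on simplexes and every facet has n+1 vertices,
-- a facet is a tuple X : Ag n → Vx with χ (X a) = a; its vertex set is
-- { X a | a }.  Simplexes are the subsets of facets.

record ChromaticComplex (n : ℕ) : Set₁ where
  field
    Vx      : Set
    _≈_     : Vx → Vx → Set
    χ       : Vx → Ag n
    IsFacet : (Ag n → Vx) → Set

  Facet : Set
  Facet = Σ (Ag n → Vx) IsFacet

  _≈ᶠ_ : Facet → Facet → Set
  X ≈ᶠ Y = ∀ a → proj₁ X a ≈ proj₁ Y a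

  -- a ∈ χ(X ∩ Y)
  _∼ᶠ⟨_⟩_ : Facet → Ag n → Facet → Set
  X ∼ᶠ⟨ a ⟩ Y = proj₁ X a ≈ proj₁ Y a

record WFComplex {n : ℕ} (C : ChromaticComplex n) : Set where
  open ChromaticComplex C
  field
    ≈-equiv     : IsEquivalence _≈_
    χ-resp      : ∀ {u v} → u ≈ v → χ u ≡ χ v
    facet-color : ∀ {X} → IsFacet X → ∀ a → χ (X a) ≡ a
    facet-resp  : ∀ {X Y} → (∀ a → X a ≈ Y a) → IsFacet X → IsFacet Y
    covered     : ∀ v → Σ Facet λ X → Σ (Ag n) λ a → proj₁ X a ≈ v

record SimplicialModel (n : ℕ) (𝒱 : Set) : Set₁ where
  field
    cpx : ChromaticComplex n
  open ChromaticComplex cpx public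
  field
    ℓ : Vx → AP n 𝒱 → Set

record WFSimplicialModel {n : ℕ} {𝒱 : Set} (M : SimplicialModel n 𝒱) : Set where
  open SimplicialModel M
  field
    wfc     : WFComplex cpx
    ℓ-resp  : ∀ {u v} → u ≈ v → ∀ p → ℓ u p → ℓ v p
    ℓ-local : ∀ v a x → ℓ v (a , x) → a ≡ χ v

record SimplicialActionModel (n : ℕ) (𝒱 : Set) : Set₁ where
  field
    cpx : ChromaticComplex n
  open ChromaticComplex cpx public
  field
    pre : Facet → Form n 𝒱

record WFSimplicialActionModel {n : ℕ} {𝒱 : Set} (𝒜 : SimplicialActionModel n 𝒱) : Set where
  open SimplicialActionModel 𝒜
  field
    wfc      : WFComplex cpx
    pre-resp : ∀ {X Y} → X ≈ᶠ Y → pre X ≡ pre Y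

module _ {n : ℕ} {𝒱 : Set} (M : SimplicialModel n 𝒱) where
  open SimplicialModel M

  ℓᶠ : Facet → AP n 𝒱 → Set
  ℓᶠ X p = Σ (Ag n) λ a → ℓ (proj₁ X a) p

  _⊨ˢ_ : Facet → Form n 𝒱 → Set
  X ⊨ˢ atom p   = ℓᶠ X p
  X ⊨ˢ (¬ᶠ φ)   = ¬ (X ⊨ˢ φ)
  X ⊨ˢ (φ ∧ᶠ ψ) = (X ⊨ˢ φ) × (X ⊨ˢ ψ)
  X ⊨ˢ K a φ    = ∀ Y → X ∼ᶠ⟨ a ⟩ Y → Y ⊨ˢ φ

record KripkeFrame (n : ℕ) : Set₁ where
  field
    St     : Set
    _≈_    : St → St → Set
    _∼⟨_⟩_ : St → Ag n → St → Set

record WFFrame {n : ℕ} (Fr : KripkeFrame n) : Set where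
  open KripkeFrame Fr
  field
    ≈-equiv : IsEquivalence _≈_
    ∼-equiv : ∀ a → IsEquivalence (λ s t → s ∼⟨ a ⟩ t)
    ∼-resp  : ∀ {a s s' t t'} → s ≈ s' → t ≈ t' → s ∼⟨ a ⟩ t → s' ∼⟨ a ⟩ t'

ProperFrame : {n : ℕ} → KripkeFrame n → Set
ProperFrame Fr = ∀ s t → (∀ a → s ∼⟨ a ⟩ t) → s ≈ t
  where open KripkeFrame Fr

record KripkeModel (n : ℕ) (𝒱 : Set) : Set₁ where
  field
    frm : KripkeFrame n
  open KripkeFrame frm public
  field
    L : St → AP n 𝒱 → Set

record WFKripkeModel {n : ℕ} {𝒱 : Set} (N : KripkeModel n 𝒱) : Set where
  open KripkeModel N
  field
    wff    : WFFrame frm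
    L-resp : ∀ {s t} → s ≈ t → ∀ p → L s p → L t p

Proper : {n : ℕ} {𝒱 : Set} → KripkeModel n 𝒱 → Set
Proper N = ProperFrame (KripkeModel.frm N)

Local : {n : ℕ} {𝒱 : Set} → KripkeModel n 𝒱 → Set
Local {n} {𝒱} N = ∀ s s' a → s ∼⟨ a ⟩ s' → ∀ (x : 𝒱) → (L s (a , x) ⇔ L s' (a , x))
  where open KripkeModel N

record ActionModel (n : ℕ) (𝒱 : Set) : Set₁ where
  field
    frm : KripkeFrame n
  open KripkeFrame frm public
  field
    pre : St → Form n 𝒱

record WFActionModel {n : ℕ} {𝒱 : Set} (B : ActionModel n 𝒱) : Set where
  open ActionModel B
  field
    wff      : WFFrame frm
    pre-resp : ∀ {s t} → s ≈ t → pre s ≡ pre t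

ProperAction : {n : ℕ} {𝒱 : Set} → ActionModel n 𝒱 → Set
ProperAction B = ProperFrame (ActionModel.frm B)

module _ {n : ℕ} {𝒱 : Set} (N : KripkeModel n 𝒱) where
  open KripkeModel N

  _⊨ᴷ_ : St → Form n 𝒱 → Set
  s ⊨ᴷ atom p   = L s p
  s ⊨ᴷ (¬ᶠ φ)   = ¬ (s ⊨ᴷ φ)
  s ⊨ᴷ (φ ∧ᶠ ψ) = (s ⊨ᴷ φ) × (s ⊨ᴷ ψ)
  s ⊨ᴷ K a φ    = ∀ t → s ∼⟨ a ⟩ t → t ⊨ᴷ φ

_[_]ᴷ : {n : ℕ} {𝒱 : Set} → KripkeModel n 𝒱 → ActionModel n 𝒱 → KripkeModel n 𝒱
_[_]ᴷ {n} {𝒱} N B = record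
  { frm = record
    { St     = Σ (N.St × B.St) λ st → _⊨ᴷ_ N (proj₁ st) (B.pre (proj₂ st))
    ; _≈_    = λ x y → N._≈_ (proj₁ (proj₁ x)) (proj₁ (proj₁ y))
                     × B._≈_ (proj₂ (proj₁ x)) (proj₂ (proj₁ y))
    ; _∼⟨_⟩_ = λ x a y → N._∼⟨_⟩_ (proj₁ (proj₁ x)) a (proj₁ (proj₁ y))
                       × B._∼⟨_⟩_ (proj₂ (proj₁ x)) a (proj₂ (proj₁ y))
    }
  ; L = λ x → N.L (proj₁ (proj₁ x))
  }
  where
  module N = KripkeModel N
  module B = ActionModel B

-- simplicial product update M[𝒜]: the subcomplex of C × T generated by
-- the facets X × Y with M, X ⊨ pre(Y)
_[_]ˢ : {n : ℕ} {𝒱 : Set} → SimplicialModel n 𝒱 → SimplicialActionModel n 𝒱 → SimplicialModel n 𝒱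
_[_]ˢ {n} {𝒱} M 𝒜 = record
  { cpx = record
    { Vx      = PV
    ; _≈_     = λ x y → M._≈_ (pu x) (pu y) × 𝒜._≈_ (pv x) (pv y)
    ; χ       = λ x → M.χ (pu x)
    ; IsFacet = λ Z → Σ (M.IsFacet (λ a → pu (Z a))) λ fx →
                      Σ (𝒜.IsFacet (λ a → pv (Z a))) λ fy →
                      _⊨ˢ_ M (_ , fx) (𝒜.pre (_ , fy))
    }
  ; ℓ = λ x → M.ℓ (pu x)
  }
  where
  module M = SimplicialModel M
  module 𝒜 = SimplicialActionModel 𝒜
  Gen : M.Vx → 𝒜.Vx → Set
  Gen u v = Σ M.Facet λ X → Σ 𝒜.Facet λ Y → _⊨ˢ_ M X (𝒜.pre Y)
            × Σ (Ag n) λ a → M._≈_ (proj₁ X a) u × 𝒜._≈_ (proj₁ Y a) v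
  PV : Set
  PV = Σ M.Vx λ u → Σ 𝒜.Vx λ v → (M.χ u ≡ 𝒜.χ v) × Gen u v
  pu : PV → M.Vx
  pu = proj₁
  pv : PV → 𝒜.Vx
  pv x = proj₁ (proj₂ x)

Fᶠ : {n : ℕ} → ChromaticComplex n → KripkeFrame n
Fᶠ C = record { St = Facet ; _≈_ = _≈ᶠ_ ; _∼⟨_⟩_ = _∼ᶠ⟨_⟩_ }
  where open ChromaticComplex C

F : {n : ℕ} {𝒱 : Set} → SimplicialModel n 𝒱 → KripkeModel n 𝒱
F M = record { frm = Fᶠ (SimplicialModel.cpx M) ; L = ℓᶠ M }

Fᵃ : {n : ℕ} {𝒱 : Set} → SimplicialActionModel n 𝒱 → ActionModel n 𝒱
Fᵃ 𝒜 = record { frm = Fᶠ (SimplicialActionModel.cpx 𝒜) ; pre = SimplicialActionModel.pre 𝒜 }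

-- G: vertices v^s_i = (s , i), identified under
-- v^s_i R v^{s'}_j iff i = j and s ∼_{a_i} s'
Gᶠ : {n : ℕ} → KripkeFrame n → ChromaticComplex n
Gᶠ {n} Fr = record
  { Vx      = St × Ag n
  ; _≈_     = λ x y → Σ (proj₂ x ≡ proj₂ y) λ _ → proj₁ x ∼⟨ proj₂ x ⟩ proj₁ y
  ; χ       = proj₂
  ; IsFacet = λ Z → Σ St λ s → ∀ a →
                Σ (proj₂ (Z a) ≡ a) λ _ → proj₁ (Z a) ∼⟨ proj₂ (Z a) ⟩ s
  }
  where open KripkeFrame Fr

G : {n : ℕ} {𝒱 : Set} → KripkeModel n 𝒱 → SimplicialModel n 𝒱
G {n} {𝒱} N = record
  { cpx = Gᶠ frm
  ; ℓ   = λ v p → (proj₁ p ≡ proj₂ v) × L (proj₁ v) p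
  }
  where open KripkeModel N

Gᵃ : {n : ℕ} {𝒱 : Set} → ActionModel n 𝒱 → SimplicialActionModel n 𝒱
Gᵃ B = record
  { cpx = Gᶠ frm
  ; pre = λ X → pre (proj₁ (proj₂ X))
  }
  where open ActionModel B

record KripkeIso {n : ℕ} {𝒱 : Set} (N N' : KripkeModel n 𝒱) : Set where
  private
    module N  = KripkeModel N
    module N' = KripkeModel N'
  field
    to        : N.St → N'.St
    from      : N'.St → N.St
    to-cong   : ∀ {s t} → s N.≈ t → to s N'.≈ to t
    from-cong : ∀ {s t} → s N'.≈ t → from s N.≈ from t
    from-to   : ∀ s → from (to s) N.≈ s
    to-from   : ∀ s → to (from s) N'.≈ s
    ∼-pres    : ∀ s t a → s N.∼⟨ a ⟩ t → to s N'.∼⟨ a ⟩ to t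
    ∼-reflect : ∀ s t a → to s N'.∼⟨ a ⟩ to t → s N.∼⟨ a ⟩ t
    L-pres    : ∀ s p → N.L s p ⇔ N'.L (to s) p

record SimplicialIso {n : ℕ} {𝒱 : Set} (M M' : SimplicialModel n 𝒱) : Set where
  private
    module M  = SimplicialModel M
    module M' = SimplicialModel M'
  field
    to         : M.Vx → M'.Vx
    from       : M'.Vx → M.Vx
    to-cong    : ∀ {u v} → u M.≈ v → to u M'.≈ to v
    from-cong  : ∀ {u v} → u M'.≈ v → from u M.≈ from v
    from-to    : ∀ u → from (to u) M.≈ u
    to-from    : ∀ u → to (from u) M'.≈ u
    to-χ       : ∀ u → M'.χ (to u) ≡ M.χ u
    from-χ     : ∀ u → M.χ (from u) ≡ M'.χ u
    to-facet   : ∀ X → M.IsFacet X → M'.IsFacet (λ a → to (X a))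
    from-facet : ∀ X → M'.IsFacet X → M.IsFacet (λ a → from (X a))
    to-ℓ       : ∀ u p → M'.ℓ (to u) p ⇔ M.ℓ u p
    from-ℓ     : ∀ u p → M.ℓ (from u) p ⇔ M'.ℓ u p

-- F leaves facets unchanged, so both sides of the first isomorphism have the facets X × Y as
-- states, and it only remains to see that M, X ⊨ φ iff F M, X ⊨ φ. For G, a facet of G N is
-- determined up to ∼ by any state witnessing it, and locality makes every vertex carry the labels
-- of each state whose facet contains it; hence G N, X ⊨ φ iff N, witness X ⊨ φ, and a vertex of
-- G N [G B] corresponds to the vertex of G (N [B]) of the same colour at the pair of witnesses.
module Submission where

open import Defs
open import Data.Nat using (ℕ)
open import Data.Product using (_×_; _,_; proj₁; proj₂)
open import Data.Product.Function.NonDependent.Propositional using (_×-⇔_)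
open import Relation.Binary.PropositionalEquality using (_≡_; refl; sym; trans)
open import Relation.Binary.Structures using (IsEquivalence)
open import Function.Bundles using (_⇔_; mk⇔; Equivalence)
open import Function.Properties.Equivalence using () renaming (refl to ⇔-refl; sym to ⇔-sym)
open import Function.Related.TypeIsomorphisms using (¬-cong-⇔)

open Equivalence using (to; from)

module _ {n : ℕ} {𝒱 : Set} (M : SimplicialModel n 𝒱) where

  F-⊨ : ∀ X φ → _⊨ˢ_ M X φ ⇔ _⊨ᴷ_ (F M) X φ
  F-⊨ X (atom p) = ⇔-refl
  F-⊨ X (¬ᶠ φ)   = ¬-cong-⇔ (F-⊨ X φ)
  F-⊨ X (φ ∧ᶠ ψ) = F-⊨ X φ ×-⇔ F-⊨ X ψ
  F-⊨ X (K a φ)  = mk⇔ (λ h Y r → to (F-⊨ Y φ) (h Y r)) (λ h Y r → from (F-⊨ Y φ) (h Y r))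

module _ {n : ℕ} {𝒱 : Set} {M : SimplicialModel n 𝒱} {𝒜 : SimplicialActionModel n 𝒱}
         (wfM : WFSimplicialModel M) (wf𝒜 : WFSimplicialActionModel 𝒜) where
  private
    module M  = SimplicialModel M
    module 𝒜  = SimplicialActionModel 𝒜
    module wfM = WFComplex (WFSimplicialModel.wfc wfM)
    module wf𝒜 = WFComplex (WFSimplicialActionModel.wfc wf𝒜)
    ≈ᴹ-refl : ∀ {u} → u M.≈ u
    ≈ᴹ-refl = IsEquivalence.refl wfM.≈-equiv
    ≈ᴬ-refl : ∀ {v} → v 𝒜.≈ v
    ≈ᴬ-refl = IsEquivalence.refl wf𝒜.≈-equiv
    module Upd = KripkeModel (F (M [ 𝒜 ]ˢ))
    module Prod = KripkeModel (F M [ Fᵃ 𝒜 ]ᴷ)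

    split : Upd.St → Prod.St
    split (Z , fx , fy , sat) =
      (((λ a → proj₁ (Z a)) , fx) , ((λ a → proj₁ (proj₂ (Z a))) , fy)) , to (F-⊨ M _ _) sat

    merge : Prod.St → Upd.St
    merge (((X , fx) , (Y , fy)) , sat) =
      (λ a → X a , Y a , colours-agree a , (X , fx) , (Y , fy) , sat′ , a , ≈ᴹ-refl , ≈ᴬ-refl)
      , fx , fy , sat′
      where
      sat′ : _⊨ˢ_ M (X , fx) (𝒜.pre (Y , fy))
      sat′ = from (F-⊨ M _ _) sat
      colours-agree : ∀ a → M.χ (X a) ≡ 𝒜.χ (Y a)
      colours-agree a = trans (wfM.facet-color fx a) (sym (wf𝒜.facet-color fy a))

  F-update-iso : KripkeIso (F (M [ 𝒜 ]ˢ)) (F M [ Fᵃ 𝒜 ]ᴷ)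
  F-update-iso = record
    { to        = split
    ; from      = merge
    ; to-cong   = λ e → (λ a → proj₁ (e a)) , (λ a → proj₂ (e a))
    ; from-cong = λ e a → proj₁ e a , proj₂ e a
    ; from-to   = λ _ _ → ≈ᴹ-refl , ≈ᴬ-refl
    ; to-from   = λ _ → (λ _ → ≈ᴹ-refl) , (λ _ → ≈ᴬ-refl)
    ; ∼-pres    = λ _ _ _ r → r
    ; ∼-reflect = λ _ _ _ r → r
    ; L-pres    = λ _ _ → ⇔-refl
    }

module GᶠProperties {n : ℕ} (Fr : KripkeFrame n) (wf : WFFrame Fr) where
  open KripkeFrame Fr
  open ChromaticComplex (Gᶠ Fr) using (Facet; _∼ᶠ⟨_⟩_; χ) renaming (Vx to Vertex; _≈_ to _≈ᵛ_)
  private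
    module ∼ a = IsEquivalence (WFFrame.∼-equiv wf a)

  ∼-refl : ∀ {a s} → s ∼⟨ a ⟩ s
  ∼-refl {a} = ∼.refl a

  ∼-sym : ∀ {a s t} → s ∼⟨ a ⟩ t → t ∼⟨ a ⟩ s
  ∼-sym {a} = ∼.sym a

  ∼-trans : ∀ {a s t u} → s ∼⟨ a ⟩ t → t ∼⟨ a ⟩ u → s ∼⟨ a ⟩ u
  ∼-trans {a} = ∼.trans a

  ∼-recolour : ∀ {a b s t} → a ≡ b → s ∼⟨ a ⟩ t → s ∼⟨ b ⟩ t
  ∼-recolour refl r = r

  -- the vertex [v^s_i] lies in the facet of t
  _∈-facetOf_ : Vertex → St → Set
  (s , i) ∈-facetOf t = s ∼⟨ i ⟩ t

  ∈-facetOf-∼ : ∀ {v t t′} → v ∈-facetOf t → v ∈-facetOf t′ → t ∼⟨ χ v ⟩ t′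
  ∈-facetOf-∼ h h′ = ∼-trans (∼-sym h) h′

  ≈-∈-facetOf : ∀ {u v t} → u ≈ᵛ v → u ∈-facetOf t → v ∈-facetOf t
  ≈-∈-facetOf (refl , r) h = ∼-trans (∼-sym r) h

  ≈-∈-facetOf-∼ : ∀ {u v t t′} → u ≈ᵛ v → u ∈-facetOf t → v ∈-facetOf t′ → t ∼⟨ χ u ⟩ t′
  ≈-∈-facetOf-∼ u≈v@(refl , _) h = ∈-facetOf-∼ (≈-∈-facetOf u≈v h)

  ∈-facetOf⇒≈ : ∀ {i v t} → i ≡ χ v → v ∈-facetOf t → (t , i) ≈ᵛ v
  ∈-facetOf⇒≈ refl h = refl , ∼-sym h

  facetOf : St → Facet
  facetOf t = (λ a → t , a) , t , λ _ → refl , ∼-refl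

  witness : Facet → St
  witness X = proj₁ (proj₂ X)

  facet-colour : ∀ (X : Facet) a → χ (proj₁ X a) ≡ a
  facet-colour (_ , _ , h) a = proj₁ (h a)

  vertex∈facetOf-witness : ∀ (X : Facet) a → proj₁ X a ∈-facetOf witness X
  vertex∈facetOf-witness (_ , _ , h) a = proj₂ (h a)

  witness-∼ : ∀ X Y a → X ∼ᶠ⟨ a ⟩ Y → witness X ∼⟨ a ⟩ witness Y
  witness-∼ X Y a XaY = ∼-recolour (facet-colour X a)
    (≈-∈-facetOf-∼ XaY (vertex∈facetOf-witness X a) (vertex∈facetOf-witness Y a))

  ∼-facetOf : ∀ X t a → witness X ∼⟨ a ⟩ t → X ∼ᶠ⟨ a ⟩ facetOf t
  ∼-facetOf X t a r = facet-colour X a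
    , ∼-trans (vertex∈facetOf-witness X a) (∼-recolour (sym (facet-colour X a)) r)

module GProperties {n : ℕ} {𝒱 : Set} (N : KripkeModel n 𝒱) (wfN : WFKripkeModel N) (loc : Local N) where
  open KripkeModel N
  open GᶠProperties frm (WFKripkeModel.wff wfN)
  private
    module GN = SimplicialModel (G N)

  ∈-facetOf⇒ℓ⇔L : ∀ {v t} → v ∈-facetOf t → ∀ p → GN.ℓ v p ⇔ ((proj₁ p ≡ proj₂ v) × L t p)
  ∈-facetOf⇒ℓ⇔L {s , i} h (b , x) = mk⇔ (λ { (refl , l) → refl , to (loc s _ i h x) l })
                                         (λ { (refl , l) → refl , from (loc s _ i h x) l })

  G-ℓᶠ : ∀ X p → ℓᶠ (G N) X p ⇔ L (witness X) p
  G-ℓᶠ X p@(b , _) = mk⇔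
    (λ (a , l) → proj₂ (to (label a) l))
    (λ l → b , from (label b) (sym (facet-colour X b) , l))
    where
    label : ∀ a → GN.ℓ (proj₁ X a) p ⇔ ((b ≡ proj₂ (proj₁ X a)) × L (witness X) p)
    label a = ∈-facetOf⇒ℓ⇔L (vertex∈facetOf-witness X a) p

  G-⊨ : ∀ X φ → _⊨ˢ_ (G N) X φ ⇔ _⊨ᴷ_ N (witness X) φ
  G-⊨ X (atom p) = G-ℓᶠ X p
  G-⊨ X (¬ᶠ φ)   = ¬-cong-⇔ (G-⊨ X φ)
  G-⊨ X (φ ∧ᶠ ψ) = G-⊨ X φ ×-⇔ G-⊨ X ψ
  G-⊨ X (K a φ)  = mk⇔
    (λ h t r → to (G-⊨ (facetOf t) φ) (h (facetOf t) (∼-facetOf X t a r)))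
    (λ h Y r → from (G-⊨ Y φ) (h (witness Y) (witness-∼ X Y a r)))

module _ {n : ℕ} {𝒱 : Set} {N : KripkeModel n 𝒱} {B : ActionModel n 𝒱}
         (wfN : WFKripkeModel N) (loc : Local N) (wfB : WFActionModel B) where
  private
    module N  = KripkeModel N
    module B  = ActionModel B
    module GN = GᶠProperties N.frm (WFKripkeModel.wff wfN)
    module GB = GᶠProperties B.frm (WFActionModel.wff wfB)
    open GProperties N wfN loc using (G-⊨; ∈-facetOf⇒ℓ⇔L)
    module Upd  = SimplicialModel (G (N [ B ]ᴷ))
    module Prod = SimplicialModel (G N [ Gᵃ B ]ˢ)

    vertexᴺ : Prod.Vx → SimplicialModel.Vx (G N)
    vertexᴺ = proj₁

    vertexᴮ : Prod.Vx → SimplicialActionModel.Vx (Gᵃ B)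
    vertexᴮ x = proj₁ (proj₂ x)

    colours-agree : ∀ x → Prod.χ x ≡ SimplicialActionModel.χ (Gᵃ B) (vertexᴮ x)
    colours-agree (_ , _ , e , _) = e

    stateᴺ : Prod.Vx → N.St
    stateᴺ (_ , _ , _ , X , _) = GN.witness X

    stateᴮ : Prod.Vx → B.St
    stateᴮ (_ , _ , _ , _ , Y , _) = GB.witness Y

    stateᴺ-⊨ : ∀ x → _⊨ᴷ_ N (stateᴺ x) (B.pre (stateᴮ x))
    stateᴺ-⊨ (_ , _ , _ , X , _ , sat , _) = to (G-⊨ X _) sat

    vertexᴺ∈facetOf-stateᴺ : ∀ x → vertexᴺ x GN.∈-facetOf stateᴺ x
    vertexᴺ∈facetOf-stateᴺ (_ , _ , _ , X , _ , _ , a , ux , _) =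
      GN.≈-∈-facetOf ux (GN.vertex∈facetOf-witness X a)

    vertexᴮ∈facetOf-stateᴮ : ∀ x → vertexᴮ x GB.∈-facetOf stateᴮ x
    vertexᴮ∈facetOf-stateᴮ (_ , _ , _ , _ , Y , _ , a , _ , vy) =
      GB.≈-∈-facetOf vy (GB.vertex∈facetOf-witness Y a)

    split : Upd.Vx → Prod.Vx
    split (((s , t) , sat) , i) =
      (s , i) , (t , i) , refl , GN.facetOf s , GB.facetOf t , from (G-⊨ (GN.facetOf s) _) sat
      , i , (refl , GN.∼-refl) , (refl , GB.∼-refl)

    merge : Prod.Vx → Upd.Vx
    merge x = ((stateᴺ x , stateᴮ x) , stateᴺ-⊨ x) , Prod.χ x

    merge-split : ∀ x → Prod._≈_ (split (merge x)) x
    merge-split x = GN.∈-facetOf⇒≈ refl (vertexᴺ∈facetOf-stateᴺ x)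
                  , GB.∈-facetOf⇒≈ (colours-agree x) (vertexᴮ∈facetOf-stateᴮ x)

    merge-cong : ∀ {x y} → x Prod.≈ y → merge x Upd.≈ merge y
    merge-cong {x} {y} (xyᴺ , xyᴮ) =
      proj₁ xyᴺ
      , GN.≈-∈-facetOf-∼ xyᴺ (vertexᴺ∈facetOf-stateᴺ x) (vertexᴺ∈facetOf-stateᴺ y)
      , GB.∼-recolour (sym (colours-agree x))
          (GB.≈-∈-facetOf-∼ xyᴮ (vertexᴮ∈facetOf-stateᴮ x) (vertexᴮ∈facetOf-stateᴮ y))

    split-facet : ∀ Z → Upd.IsFacet Z → Prod.IsFacet (λ a → split (Z a))
    split-facet Z (((s , t) , sat) , h) =
      fx , (t , λ a → proj₁ (h a) , proj₂ (proj₂ (h a))) , from (G-⊨ (_ , fx) _) sat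
      where
      fx : SimplicialModel.IsFacet (G N) (λ a → vertexᴺ (split (Z a)))
      fx = s , λ a → proj₁ (h a) , proj₁ (proj₂ (h a))

    merge-facet : ∀ Z → Prod.IsFacet Z → Upd.IsFacet (λ a → merge (Z a))
    merge-facet Z (fx@(s , hx) , (t , hy) , sat) =
      ((s , t) , to (G-⊨ (_ , fx) _) sat)
      , λ a → proj₁ (hx a)
            , GN.∈-facetOf-∼ (vertexᴺ∈facetOf-stateᴺ (Z a)) (proj₂ (hx a))
            , GB.∼-recolour (sym (colours-agree (Z a)))
                (GB.∈-facetOf-∼ (vertexᴮ∈facetOf-stateᴮ (Z a)) (proj₂ (hy a)))

  G-update-iso : SimplicialIso (G (N [ B ]ᴷ)) (G N [ Gᵃ B ]ˢ)
  G-update-iso = record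
    { to         = split
    ; from       = merge
    ; to-cong    = λ (e , rᴺ , rᴮ) → (e , rᴺ) , (e , rᴮ)
    ; from-cong  = λ {x} {y} → merge-cong {x} {y}
    ; from-to    = λ _ → refl , GN.∼-refl , GB.∼-refl
    ; to-from    = merge-split
    ; to-χ       = λ _ → refl
    ; from-χ     = λ _ → refl
    ; to-facet   = split-facet
    ; from-facet = merge-facet
    ; to-ℓ       = λ _ _ → ⇔-refl
    ; from-ℓ     = λ x p → ⇔-sym (∈-facetOf⇒ℓ⇔L (vertexᴺ∈facetOf-stateᴺ x) p)
    }

proposition11 :
    ((n : ℕ) (𝒱 : Set) (M : SimplicialModel n 𝒱) (𝒜 : SimplicialActionModel n 𝒱) →
      WFSimplicialModel M → WFSimplicialActionModel 𝒜 →
      KripkeIso (F (M [ 𝒜 ]ˢ)) (F M [ Fᵃ 𝒜 ]ᴷ))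
    ×
    ((n : ℕ) (𝒱 : Set) (N : KripkeModel n 𝒱) (B : ActionModel n 𝒱) →
      WFKripkeModel N → Local N → Proper N → WFActionModel B → ProperAction B →
      SimplicialIso (G (N [ B ]ᴷ)) (G N [ Gᵃ B ]ˢ))
proposition11 =
    (λ _ _ _ _ wfM wf𝒜 → F-update-iso wfM wf𝒜)
  , (λ _ _ _ _ wfN loc _ wfB _ → G-update-iso wfN loc wfB)
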